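{- Every allowed formula is domain independent.
   Context: Language: finite set $\mathcal R$ of relation symbols with arities $\delta(r)$; finite linearly ordered set $\mathcal X$ of variables. Formulas: $1$; $r(x_1,\ldots,x_n)$ ($\delta(r)=n$); $(x\approx y)$ (equality is not a relation symbol); $\neg\varphi$; $(\varphi\wedge\psi)$; $(\varphi\vee\psi)$; $(\exists x)\varphi$. $\mathrm{FV}$ denotes free variables as usual ($\mathrm{FV}(1)=\emptyset$, $\mathrm{FV}(x\approx y)=\{x,y\}$, etc.). A structure $M$: nonempty finite set $M$ with $r^M\subseteq M^{\delta(r)}$. $\mathcal V=M^{\mathcal X}$; $\overline V=\mathcal V\setminus V$; $u=_xv$ iff $u,v$ agree off $x$; $\mathrm C_x(V)=\{v:\exists u\in V,u=_xv\}$; $\mathrm D_{xy}=\{v:v(x)=v(y)\}$. Value: $\|1\|=\mathcal V$, $\|r(x_1,\ldots,x_n)\|=\{v:(v(x_1),\ldots,v(x_n))\in r^M\}$, $\|x\approx y\|=\mathrm D_{xy}$, $\|\neg\varphi\|=\overline{\|\varphi\|}$, $\wedge\mapsto\cap$, $\vee\mapsto\cup$, $\|(\exists x)\varphi\|=\mathrm C_x(\|\varphi\|)$. For $V\subseteq\mathcal V$ and $X\subseteq\mathcal X$, $\pi_X(V)=\{v|_X:v\in V\}$. Two structures $M_1,M_2$ differ only in domains if $r^{M_1}=r^{M_2}$ for all $r\in\mathcal R$. A formula $\varphi$ is domain independent if $\pi_{\mathrm{FV}(\varphi)}(\|\varphi\|_{M_1})=\pi_{\mathrm{FV}(\varphi)}(\|\varphi\|_{M_2})$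 for all structures $M_1,M_2$ differing only in domains. Allowed formulas: in the following recursive definitions $\varphi\vee\psi$ is treated as $\neg(\neg\varphi\wedge\neg\psi)$. $\mathrm{Eq}(R)$ is the least equivalence on $\mathcal X$ containing $R$, $\mathrm{id}_{\mathcal X}$ the identity. $eq(1)=coeq(1)=eq(r(\ldots))=coeq(r(\ldots))=coeq(x\approx y)=\mathrm{id}_{\mathcal X}$, $eq(x_1\approx x_2)=\mathrm{Eq}(\{\langle x_1,x_2\rangle\})$; $eq(\neg\varphi)=coeq(\varphi)$, $coeq(\neg\varphi)=eq(\varphi)$; $eq(\varphi\wedge\psi)=\mathrm{Eq}(eq(\varphi)\cup eq(\psi))$, $coeq(\varphi\wedge\psi)=coeq(\varphi)\cap coeq(\psi)$; $eq((\exists x)\varphi)=\mathrm{Eq}(eq(\varphi)\cap(\mathcal X\setminus\{x\})^2)$, likewise $coeq$. $\mathrm{cl}_E(X)=\{y:\langle x,y\rangle\in E,\ x\in X\}$. $gen_0(1)=cogen_0(1)=\emptyset$; $gen_0(r(x_1,\ldots,x_n))=\{x_1,\ldots,x_n\}$, $cogen_0(r(\ldots))=\emptyset$; $gen_0(x\approx y)=cogen_0(x\approx y)=\emptyset$; $gen_0(\neg\varphi)=cogen_0(\varphi)$, $cogen_0(\neg\varphi)=gen_0(\varphi)$; $gen_0(\varphi\wedge\psi)=\mathrm{cl}_{eq(\varphi\wedge\psi)}(gen_0(\varphi)\cup gen_0(\psi))$, $cogen_0(\varphi\wedge\psi)=cogen_0(\varphi)\cap cogen_0(\psi)$; $gen_0((\exists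 x)\varphi)=gen_0(\varphi)\setminus\{x\}$, $cogen_0((\exists x)\varphi)=cogen_0(\varphi)\setminus\{x\}$. A formula $\varphi$ is allowed if $\mathrm{FV}(\varphi)=gen_0(\varphi)$ and every subformula $(\exists x)\psi$ of $\varphi$ satisfies $x\in gen_0(\psi)$. -}

module Defs where

open import Data.Nat using (ℕ)
open import Data.Fin using (Fin; _≟_)
open import Data.Vec using (Vec)
import Data.Vec as Vec
open import Data.Vec.Membership.Propositional using () renaming (_∈_ to _∈ᵥ_)
open import Data.List using (List; [])
open import Data.Bool.ListAction using (any)
open import Data.List.Membership.Propositional using (_∈_)
open import Data.Bool using (Bool; true; false; if_then_else_; not; _∧_; _∨_)
open import Data.Product using (_×_; Σ; ∃; _,_)
open import Data.Sum using (_⊎_)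
open import Data.Empty using (⊥)
open import Data.Unit using (⊤)
open import Relation.Nullary using (¬_; does)
open import Relation.Binary.PropositionalEquality using (_≡_; _≢_)
open import Relation.Binary.Definitions using (DecidableEquality)
open import Relation.Binary.Construct.Closure.Equivalence using (EqClosure)
open import Function.Bundles using (_⇔_)

infixr 6 _∧ᶠ_
infixr 5 _∨ᶠ_

data Formula {k : ℕ} (δ : Fin k → ℕ) (n : ℕ) : Set where
  𝟙    : Formula δ n
  rel  : (r : Fin k) → Vec (Fin n) (δ r) → Formula δ n
  _≈ᶠ_ : Fin n → Fin n → Formula δ n
  ¬ᶠ_  : Formula δ n → Formula δ n
  _∧ᶠ_ : Formula δ n → Formula δ n → Formula δ n
  _∨ᶠ_ : Formula δ n → Formula δ n → Formula δ n
  ∃ᶠ   : Fin n → Formula δ n → Formula δ n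

module _ {k : ℕ} {δ : Fin k → ℕ} {n : ℕ} where

  VarSet : Set₁
  VarSet = Fin n → Set

  VarRel : Set₁
  VarRel = Fin n → Fin n → Set

  FV : Formula δ n → VarSet
  FV 𝟙          y = ⊥
  FV (rel r xs) y = y ∈ᵥ xs
  FV (x ≈ᶠ x')  y = y ≡ x ⊎ y ≡ x'
  FV (¬ᶠ φ)     y = FV φ y
  FV (φ ∧ᶠ ψ)   y = FV φ y ⊎ FV ψ y
  FV (φ ∨ᶠ ψ)   y = FV φ y ⊎ FV ψ y
  FV (∃ᶠ x φ)   y = FV φ y × y ≢ x

  cl : VarRel → VarSet → VarSet
  cl E X y = ∃ λ x → X x × E x y

  without : Fin n → VarRel → VarRel
  without x E a b = E a b × a ≢ x × b ≢ x

  -- eq / coeq.  φ ∨ ψ is treated as ¬(¬φ ∧ ¬ψ); the ∨-clauses below are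
  -- exactly what the ∧/¬ clauses give for ¬(¬φ ∧ ¬ψ).
  eqᶠ coeqᶠ : Formula δ n → VarRel
  eqᶠ 𝟙          = _≡_
  eqᶠ (rel r xs) = _≡_
  eqᶠ (x ≈ᶠ x')  = EqClosure (λ a b → a ≡ x × b ≡ x')
  eqᶠ (¬ᶠ φ)     = coeqᶠ φ
  eqᶠ (φ ∧ᶠ ψ)   = EqClosure (λ a b → eqᶠ φ a b ⊎ eqᶠ ψ a b)
  eqᶠ (φ ∨ᶠ ψ)   = λ a b → eqᶠ φ a b × eqᶠ ψ a b
  eqᶠ (∃ᶠ x φ)   = EqClosure (without x (eqᶠ φ))
  coeqᶠ 𝟙          = _≡_
  coeqᶠ (rel r xs) = _≡_
  coeqᶠ (x ≈ᶠ x')  = _≡_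
  coeqᶠ (¬ᶠ φ)     = eqᶠ φ
  coeqᶠ (φ ∧ᶠ ψ)   = λ a b → coeqᶠ φ a b × coeqᶠ ψ a b
  coeqᶠ (φ ∨ᶠ ψ)   = EqClosure (λ a b → coeqᶠ φ a b ⊎ coeqᶠ ψ a b)
  coeqᶠ (∃ᶠ x φ)   = EqClosure (without x (coeqᶠ φ))

  -- gen₀ / cogen₀ (∨ again treated as ¬(¬φ ∧ ¬ψ))
  gen₀ cogen₀ : Formula δ n → VarSet
  gen₀ 𝟙          y = ⊥
  gen₀ (rel r xs) y = y ∈ᵥ xs
  gen₀ (x ≈ᶠ x')  y = ⊥
  gen₀ (¬ᶠ φ)     y = cogen₀ φ y
  gen₀ (φ ∧ᶠ ψ)   y = cl (eqᶠ (φ ∧ᶠ ψ)) (λ z → gen₀ φ z ⊎ gen₀ ψ z) y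
  gen₀ (φ ∨ᶠ ψ)   y = gen₀ φ y × gen₀ ψ y
  gen₀ (∃ᶠ x φ)   y = gen₀ φ y × y ≢ x
  cogen₀ 𝟙          y = ⊥
  cogen₀ (rel r xs) y = ⊥
  cogen₀ (x ≈ᶠ x')  y = ⊥
  cogen₀ (¬ᶠ φ)     y = gen₀ φ y
  cogen₀ (φ ∧ᶠ ψ)   y = cogen₀ φ y × cogen₀ ψ y
  cogen₀ (φ ∨ᶠ ψ)   y = cl (EqClosure (λ a b → coeqᶠ φ a b ⊎ coeqᶠ ψ a b))
                           (λ z → cogen₀ φ z ⊎ cogen₀ ψ z) y
  cogen₀ (∃ᶠ x φ)   y = cogen₀ φ y × y ≢ x

  ExistsGenerated : Formula δ n → Set
  ExistsGenerated 𝟙          = ⊤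
  ExistsGenerated (rel r xs) = ⊤
  ExistsGenerated (x ≈ᶠ x')  = ⊤
  ExistsGenerated (¬ᶠ φ)     = ExistsGenerated φ
  ExistsGenerated (φ ∧ᶠ ψ)   = ExistsGenerated φ × ExistsGenerated ψ
  ExistsGenerated (φ ∨ᶠ ψ)   = ExistsGenerated φ × ExistsGenerated ψ
  ExistsGenerated (∃ᶠ x φ)   = gen₀ φ x × ExistsGenerated φ

  Allowed : Formula δ n → Set
  Allowed φ = (∀ y → FV φ y ⇔ gen₀ φ y) × ExistsGenerated φ

-- All structures live inside an ambient type U (so that
-- r^{M₁} = r^{M₂} makes sense); the domain is a finite nonempty list
-- of elements of U, relations are decidable subsets of U^{δ(r)}
-- contained in M^{δ(r)}.

record Structure {k : ℕ} (δ : Fin k → ℕ) (U : Set) : Set where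
  field
    dom        : List U
    nonempty   : dom ≢ []
    relᴹ       : (r : Fin k) → Vec U (δ r) → Bool
    relᴹ-inDom : ∀ r (t : Vec U (δ r)) → relᴹ r t ≡ true →
                 ∀ a → a ∈ᵥ t → a ∈ dom

open Structure public

DifferOnlyInDomains : ∀ {k} {δ : Fin k → ℕ} {U} → Structure δ U → Structure δ U → Set
DifferOnlyInDomains {δ = δ} M₁ M₂ = ∀ r (t : Vec _ (δ r)) → relᴹ M₁ r t ≡ relᴹ M₂ r t

module _ {k : ℕ} {δ : Fin k → ℕ} {n : ℕ} {U : Set} (_≟U_ : DecidableEquality U) where

  update : (Fin n → U) → Fin n → U → (Fin n → U)
  update v x a y = if does (y ≟ x) then a else v y

  sat : Structure δ U → Formula δ n → (Fin n → U) → Bool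
  sat M 𝟙          v = true
  sat M (rel r xs) v = relᴹ M r (Vec.map v xs)
  sat M (x ≈ᶠ x')  v = does (v x ≟U v x')
  sat M (¬ᶠ φ)     v = not (sat M φ v)
  sat M (φ ∧ᶠ ψ)   v = sat M φ v ∧ sat M ψ v
  sat M (φ ∨ᶠ ψ)   v = sat M φ v ∨ sat M ψ v
  sat M (∃ᶠ x φ)   v = any (λ a → sat M φ (update v x a)) (dom M)

  -- w|_{FV(φ)} ∈ π_{FV(φ)}(‖φ‖_M); only the values of w on FV(φ) matter
  InProj : Structure δ U → Formula δ n → (Fin n → U) → Set
  InProj M φ w = Σ (Fin n → U) λ v →
    (∀ x → v x ∈ dom M) × sat M φ v ≡ true × (∀ x → FV φ x → v x ≡ w x)

  DomainIndependent : Formula δ n → Set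
  DomainIndependent φ = ∀ (M₁ M₂ : Structure δ U) → DifferOnlyInDomains M₁ M₂ →
    ∀ (w : Fin n → U) → InProj M₁ φ w ⇔ InProj M₂ φ w

-- If an assignment satisfies (resp. falsifies) φ, it identifies the variables related by
-- eq(φ) (resp. coeq(φ)) and sends every variable of gen₀(φ) (resp. cogen₀(φ)) into the
-- active domain, i.e. to an element occurring in a tuple of some relation.  Structures
-- that differ only in domains have the same active domain.  Hence, when every ∃x ψ has
-- x ∈ gen₀(ψ), the witness found for x in one structure is active and so also lies in
-- the other domain: satisfaction is the same in both.  Finally FV(φ) = gen₀(φ) makes the
-- free variables of a satisfying assignment active, so the remaining variables may be
-- moved into either domain without changing the projection.
module Submission where

open import Defs
open import Data.Nat using (ℕ)
open import Data.Fin using (Fin) renaming (_≟_ to _≟F_)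
open import Data.Vec using (Vec; []; _∷_)
import Data.Vec as Vec
open import Data.Vec.Relation.Unary.Any using (here; there)
open import Data.Vec.Membership.Propositional using () renaming (_∈_ to _∈ᵥ_)
open import Data.Vec.Membership.Propositional.Properties using (∈-map⁺)
open import Data.List using ([]; _∷_)
import Data.List.Properties as List
import Data.List.Relation.Unary.Any as Any
open import Data.List.Relation.Unary.Any.Properties using (any⁺; any⁻)
open import Data.List.Membership.Propositional using (_∈_; find; lose)
import Data.List.Membership.DecPropositional as DecMembership
open import Data.Bool using (Bool; true; false; if_then_else_; not; _∧_; _∨_)
open import Data.Bool.Properties using (T-≡; ∧-conicalˡ; ∧-conicalʳ; ∨-conicalˡ; ∨-conicalʳ)
open import Data.Bool.ListAction using (any; or)
open import Data.Product using (_×_; ∃; ∃₂; _,_; proj₁; proj₂)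
open import Data.Sum using (_⊎_; inj₁; inj₂; [_,_])
open import Data.Empty using (⊥-elim)
open import Relation.Nullary using (Dec; does; yes; no)
open import Relation.Binary.Definitions using (DecidableEquality)
open import Relation.Binary.PropositionalEquality
  using (_≡_; _≢_; refl; sym; trans; cong; cong₂; subst; isEquivalence)
open import Relation.Binary.Construct.Closure.Equivalence using (EqClosure; gfold)
open import Function.Base using (_∘_)
open import Function.Bundles using (mk⇔; Equivalence)

∧-≡false : ∀ b c → b ∧ c ≡ false → b ≡ false ⊎ c ≡ false
∧-≡false false c _ = inj₁ refl
∧-≡false true  c p = inj₂ p

∨-≡true : ∀ b c → b ∨ c ≡ true → b ≡ true ⊎ c ≡ true
∨-≡true true  c _ = inj₁ refl
∨-≡true false c p = inj₂ p

not-≡true : ∀ {b} → not b ≡ true → b ≡ false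
not-≡true {false} _ = refl

not-≡false : ∀ {b} → not b ≡ false → b ≡ true
not-≡false {true} _ = refl

does≡true⇒ : ∀ {A : Set} (a? : Dec A) → does a? ≡ true → A
does≡true⇒ (yes a) _ = a

≡true-equivalent⇒≡ : ∀ {b c} → (b ≡ true → c ≡ true) → (c ≡ true → b ≡ true) → b ≡ c
≡true-equivalent⇒≡ {true}  b⇒c _   = sym (b⇒c refl)
≡true-equivalent⇒≡ {false} {true}  _ c⇒b = c⇒b refl
≡true-equivalent⇒≡ {false} {false} _ _   = refl

module _ {A : Set} (p : A → Bool) where

  any-witness : ∀ xs → any p xs ≡ true → ∃ λ a → a ∈ xs × p a ≡ true
  any-witness xs any≡true =
    let a , a∈xs , pa = find (any⁻ p xs (Equivalence.from T-≡ any≡true))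
    in a , a∈xs , Equivalence.to T-≡ pa

  any-≡true : ∀ {a xs} → a ∈ xs → p a ≡ true → any p xs ≡ true
  any-≡true a∈xs pa = Equivalence.to T-≡ (any⁺ p (lose a∈xs (Equivalence.from T-≡ pa)))

  any-≡false : ∀ {a xs} → any p xs ≡ false → a ∈ xs → p a ≡ false
  any-≡false {a} any≡false a∈xs with p a in pa
  ... | false = refl
  ... | true with () ← trans (sym (any-≡true a∈xs pa)) any≡false

any-cong : ∀ {A : Set} {p q : A → Bool} → (∀ a → p a ≡ q a) → ∀ xs → any p xs ≡ any q xs
any-cong p≗q xs = cong or (List.map-cong p≗q xs)

map-cong-∈ : ∀ {A B : Set} {m} {f g : A → B} (xs : Vec A m) →
             (∀ {x} → x ∈ᵥ xs → f x ≡ g x) → Vec.map f xs ≡ Vec.map g xs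
map-cong-∈ []       _   = refl
map-cong-∈ (x ∷ xs) f≗g = cong₂ _∷_ (f≗g (here refl)) (map-cong-∈ xs (f≗g ∘ there))

retractInto : ∀ {I A : Set} → DecidableEquality A → ∀ {d xs} → d ∈ xs → (v : I → A) →
              ∃ λ v' → (∀ i → v' i ∈ xs) × (∀ {i} → v i ∈ xs → v' i ≡ v i)
retractInto {I} {A} _≟_ {d} {xs} d∈xs v = v' , v'∈xs , v'≡v
  where
  open DecMembership _≟_ using (_∈?_)
  v' : I → A
  v' i = if does (v i ∈? xs) then v i else d
  v'∈xs : ∀ i → v' i ∈ xs
  v'∈xs i with v i ∈? xs
  ... | yes vi∈xs = vi∈xs
  ... | no  _     = d∈xs
  v'≡v : ∀ {i} → v i ∈ xs → v' i ≡ v i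
  v'≡v {i} vi∈xs with v i ∈? xs
  ... | yes _     = refl
  ... | no  vi∉xs = ⊥-elim (vi∉xs vi∈xs)

EqClosure-respects : ∀ {A B : Set} {R : A → A → Set} (f : A → B) →
                     (∀ {a b} → R a b → f a ≡ f b) → ∀ {a b} → EqClosure R a b → f a ≡ f b
EqClosure-respects f R⇒≡ = gfold isEquivalence f R⇒≡

module _ {k : ℕ} {δ : Fin k → ℕ} {U : Set} where

  Active : Structure δ U → U → Set
  Active M a = ∃₂ λ r (t : Vec U (δ r)) → relᴹ M r t ≡ true × a ∈ᵥ t

  active⇒∈dom : ∀ M {a} → Active M a → a ∈ dom M
  active⇒∈dom M (r , t , t∈r , a∈t) = relᴹ-inDom M r t t∈r _ a∈t

  active-transfer : ∀ (M₁ M₂ : Structure δ U) → DifferOnlyInDomains M₁ M₂ →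
                    ∀ {a} → Active M₁ a → Active M₂ a
  active-transfer _ _ same (r , t , t∈r , a∈t) = r , t , trans (sym (same r t)) t∈r , a∈t

  DifferOnlyInDomains-sym : ∀ (M₁ M₂ : Structure δ U) →
                            DifferOnlyInDomains M₁ M₂ → DifferOnlyInDomains M₂ M₁
  DifferOnlyInDomains-sym _ _ same r t = sym (same r t)

  dom-inhabited : ∀ (M : Structure δ U) → ∃ (_∈ dom M)
  dom-inhabited M with dom M | nonempty M
  ... | []    | ≢[] = ⊥-elim (≢[] refl)
  ... | a ∷ _ | _   = a , Any.here refl

module _ {k : ℕ} {δ : Fin k → ℕ} {n : ℕ} {U : Set} (_≟U_ : DecidableEquality U) where

  private
    Assignment : Set
    Assignment = Fin n → U

    _[_↦_] : Assignment → Fin n → U → Assignment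
    _[_↦_] = update {k} {δ} _≟U_

    ⟦_⟧ : Formula δ n → Structure δ U → Assignment → Bool
    ⟦ φ ⟧ M = sat _≟U_ M φ

  update-≢ : ∀ v {x} a {y} → y ≢ x → (v [ x ↦ a ]) y ≡ v y
  update-≢ v {x} a {y} y≢x with y ≟F x
  ... | yes y≡x = ⊥-elim (y≢x y≡x)
  ... | no  _   = refl

  update-≡ : ∀ v x a → (v [ x ↦ a ]) x ≡ a
  update-≡ v x a with x ≟F x
  ... | yes _   = refl
  ... | no  x≢x = ⊥-elim (x≢x refl)

  update-cong : ∀ v v' x a {y} → (y ≢ x → v y ≡ v' y) → (v [ x ↦ a ]) y ≡ (v' [ x ↦ a ]) y
  update-cong v v' x a {y} agree with y ≟F x
  ... | yes _   = refl
  ... | no  y≢x = agree y≢x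

  record Confined (M : Structure δ U) (E : Fin n → Fin n → Set) (X : Fin n → Set)
                  (v : Assignment) : Set where
    field
      equal  : ∀ {x y} → E x y → v x ≡ v y
      active : ∀ {x} → X x → Active M (v x)

  open Confined

  module _ {M : Structure δ U} {v : Assignment} where

    confined-≡ : ∀ {X} → (∀ {x} → X x → Active M (v x)) → Confined M _≡_ X v
    confined-≡ X-active = record { equal = cong v ; active = X-active }

    confined-mono : ∀ {E E' X X'} → (∀ {x y} → E' x y → E x y) → (∀ {x} → X' x → X x) →
                    Confined M E X v → Confined M E' X' v
    confined-mono E'⊆E X'⊆X c = record { equal = equal c ∘ E'⊆E ; active = active c ∘ X'⊆X }

    confined-join : ∀ {E E' X X'} → Confined M E X v → Confined M E' X' v →
                    let E∨E' = EqClosure (λ a b → E a b ⊎ E' a b) in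
                    Confined M E∨E' (cl {δ = δ} E∨E' (λ z → X z ⊎ X' z)) v
    confined-join c c' = record
      { equal  = equalsJoin
      ; active = λ (z , z∈X∪X' , zEy) →
                   subst (Active M) (equalsJoin zEy) ([ active c , active c' ] z∈X∪X')
      }
      where equalsJoin = EqClosure-respects v [ equal c , equal c' ]

  confined-∃ : ∀ {M E X} v x a → Confined M E X (v [ x ↦ a ]) →
               Confined M (EqClosure (without {δ = δ} x E)) (λ y → X y × y ≢ x) v
  confined-∃ {M} v x a c = record
    { equal  = EqClosure-respects v λ (aEb , a≢x , b≢x) →
                 trans (sym (update-≢ v a a≢x)) (trans (equal c aEb) (update-≢ v a b≢x))
    ; active = λ (y∈X , y≢x) → subst (Active M) (update-≢ v a y≢x) (active c y∈X)
    }

  sat-true⇒confined  : ∀ M φ v → ⟦ φ ⟧ M v ≡ true  → Confined M (eqᶠ φ) (gen₀ φ) v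
  sat-false⇒confined : ∀ M φ v → ⟦ φ ⟧ M v ≡ false → Confined M (coeqᶠ φ) (cogen₀ φ) v

  sat-true⇒confined M 𝟙          v _     = confined-≡ λ ()
  sat-true⇒confined M (rel r xs) v holds =
    confined-≡ λ x∈xs → r , Vec.map v xs , holds , ∈-map⁺ v x∈xs
  sat-true⇒confined M (x ≈ᶠ x')  v holds = record
    { equal  = EqClosure-respects v λ { (refl , refl) → does≡true⇒ (v x ≟U v x') holds }
    ; active = λ ()
    }
  sat-true⇒confined M (¬ᶠ φ)     v holds = sat-false⇒confined M φ v (not-≡true holds)
  sat-true⇒confined M (φ ∧ᶠ ψ)   v holds =
    confined-join (sat-true⇒confined M φ v (∧-conicalˡ _ _ holds))
                  (sat-true⇒confined M ψ v (∧-conicalʳ _ _ holds))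
  sat-true⇒confined M (φ ∨ᶠ ψ)   v holds with ∨-≡true _ _ holds
  ... | inj₁ φ-holds = confined-mono proj₁ proj₁ (sat-true⇒confined M φ v φ-holds)
  ... | inj₂ ψ-holds = confined-mono proj₂ proj₂ (sat-true⇒confined M ψ v ψ-holds)
  sat-true⇒confined M (∃ᶠ x φ)   v holds =
    let a , _ , φ-holds = any-witness _ (dom M) holds
    in confined-∃ v x a (sat-true⇒confined M φ (v [ x ↦ a ]) φ-holds)

  sat-false⇒confined M 𝟙          v ()
  sat-false⇒confined M (rel r xs) v _     = confined-≡ λ ()
  sat-false⇒confined M (x ≈ᶠ x')  v _     = confined-≡ λ ()
  sat-false⇒confined M (¬ᶠ φ)     v fails = sat-true⇒confined M φ v (not-≡false fails)
  sat-false⇒confined M (φ ∧ᶠ ψ)   v fails with ∧-≡false _ _ fails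
  ... | inj₁ φ-fails = confined-mono proj₁ proj₁ (sat-false⇒confined M φ v φ-fails)
  ... | inj₂ ψ-fails = confined-mono proj₂ proj₂ (sat-false⇒confined M ψ v ψ-fails)
  sat-false⇒confined M (φ ∨ᶠ ψ)   v fails =
    confined-join (sat-false⇒confined M φ v (∨-conicalˡ _ _ fails))
                  (sat-false⇒confined M ψ v (∨-conicalʳ _ _ fails))
  sat-false⇒confined M (∃ᶠ x φ)   v fails =
    let a , a∈dom = dom-inhabited M
    in confined-∃ v x a (sat-false⇒confined M φ (v [ x ↦ a ]) (any-≡false _ fails a∈dom))

  ∃-holds-transfer : ∀ M₁ M₂ → DifferOnlyInDomains M₁ M₂ →
                     ∀ x φ → gen₀ φ x → (∀ u → ⟦ φ ⟧ M₁ u ≡ ⟦ φ ⟧ M₂ u) →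
                     ∀ v → ⟦ ∃ᶠ x φ ⟧ M₁ v ≡ true → ⟦ ∃ᶠ x φ ⟧ M₂ v ≡ true
  ∃-holds-transfer M₁ M₂ same x φ x-gen φ-same v holds =
    let a , _ , φ-holds = any-witness _ (dom M₁) holds
        a-active : Active M₁ a
        a-active = subst (Active M₁) (update-≡ v x a)
                         (active (sat-true⇒confined M₁ φ (v [ x ↦ a ]) φ-holds) x-gen)
    in any-≡true _ (active⇒∈dom M₂ (active-transfer M₁ M₂ same a-active))
                   (trans (sym (φ-same (v [ x ↦ a ]))) φ-holds)

  module _ (M₁ M₂ : Structure δ U) (same : DifferOnlyInDomains M₁ M₂) where

    sat-transfer : ∀ φ → ExistsGenerated φ → ∀ v → ⟦ φ ⟧ M₁ v ≡ ⟦ φ ⟧ M₂ v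
    sat-transfer 𝟙          _               v = refl
    sat-transfer (rel r xs) _               v = same r (Vec.map v xs)
    sat-transfer (x ≈ᶠ x')  _               v = refl
    sat-transfer (¬ᶠ φ)     φ-gen           v = cong not (sat-transfer φ φ-gen v)
    sat-transfer (φ ∧ᶠ ψ)   (φ-gen , ψ-gen) v =
      cong₂ _∧_ (sat-transfer φ φ-gen v) (sat-transfer ψ ψ-gen v)
    sat-transfer (φ ∨ᶠ ψ)   (φ-gen , ψ-gen) v =
      cong₂ _∨_ (sat-transfer φ φ-gen v) (sat-transfer ψ ψ-gen v)
    sat-transfer (∃ᶠ x φ)   (x-gen , φ-gen) v =
      ≡true-equivalent⇒≡ (∃-holds-transfer M₁ M₂ same x φ x-gen φ-same v)
                         (∃-holds-transfer M₂ M₁ (DifferOnlyInDomains-sym M₁ M₂ same)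
                                           x φ x-gen (sym ∘ φ-same) v)
      where φ-same = sat-transfer φ φ-gen

  sat-cong-FV : ∀ M φ v v' → (∀ {y} → FV φ y → v y ≡ v' y) → ⟦ φ ⟧ M v ≡ ⟦ φ ⟧ M v'
  sat-cong-FV M 𝟙          v v' agree = refl
  sat-cong-FV M (rel r xs) v v' agree = cong (relᴹ M r) (map-cong-∈ xs agree)
  sat-cong-FV M (x ≈ᶠ x')  v v' agree =
    cong₂ (λ a b → does (a ≟U b)) (agree (inj₁ refl)) (agree (inj₂ refl))
  sat-cong-FV M (¬ᶠ φ)     v v' agree = cong not (sat-cong-FV M φ v v' agree)
  sat-cong-FV M (φ ∧ᶠ ψ)   v v' agree =
    cong₂ _∧_ (sat-cong-FV M φ v v' (agree ∘ inj₁)) (sat-cong-FV M ψ v v' (agree ∘ inj₂))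
  sat-cong-FV M (φ ∨ᶠ ψ)   v v' agree =
    cong₂ _∨_ (sat-cong-FV M φ v v' (agree ∘ inj₁)) (sat-cong-FV M ψ v v' (agree ∘ inj₂))
  sat-cong-FV M (∃ᶠ x φ)   v v' agree = any-cong agree-updated (dom M)
    where
    agree-updated : ∀ a → ⟦ φ ⟧ M (v [ x ↦ a ]) ≡ ⟦ φ ⟧ M (v' [ x ↦ a ])
    agree-updated a = sat-cong-FV M φ (v [ x ↦ a ]) (v' [ x ↦ a ])
      λ y∈FV → update-cong v v' x a λ y≢x → agree (y∈FV , y≢x)

  InProj-transfer : ∀ M₁ M₂ → DifferOnlyInDomains M₁ M₂ → ∀ φ → Allowed φ → ∀ w →
                    InProj _≟U_ M₁ φ w → InProj _≟U_ M₂ φ w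
  InProj-transfer M₁ M₂ same φ (FV⇔gen , ∃-gen) w (v , _ , holds₁ , v≡w) =
    let v' , v'∈dom , v'≡v = retractInto _≟U_ (proj₂ (dom-inhabited M₂)) v
        v'≡v-on-FV : ∀ {y} → FV φ y → v' y ≡ v y
        v'≡v-on-FV {y} y∈FV = v'≡v (active⇒∈dom M₂ (FV-active (Equivalence.to (FV⇔gen y) y∈FV)))
    in v' , v'∈dom , trans (sat-cong-FV M₂ φ v' v v'≡v-on-FV) holds₂ ,
       λ y y∈FV → trans (v'≡v-on-FV y∈FV) (v≡w y y∈FV)
    where
    holds₂ : ⟦ φ ⟧ M₂ v ≡ true
    holds₂ = trans (sym (sat-transfer M₁ M₂ same φ ∃-gen v)) holds₁
    FV-active : ∀ {y} → gen₀ φ y → Active M₂ (v y)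
    FV-active = active (sat-true⇒confined M₂ φ v holds₂)

theorem6p9 : ∀ {k : ℕ} (δ : Fin k → ℕ) (n : ℕ) (U : Set) (_≟U_ : DecidableEquality U)
             (φ : Formula δ n) → Allowed φ → DomainIndependent _≟U_ φ
theorem6p9 δ n U _≟U_ φ allowed M₁ M₂ same w =
  mk⇔ (InProj-transfer _≟U_ M₁ M₂ same φ allowed w)
      (InProj-transfer _≟U_ M₂ M₁ (DifferOnlyInDomains-sym M₁ M₂ same) φ allowed w)
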